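{- For every integer $n\ge 1$, with $k=n(n+1)$, there exists a graph $G$ on $k$ vertices such that the Boolean quadratic polytope $\mathrm{BQP}_n$ is affinely equivalent to the stable set polytope $\mathrm{SSP}(G)$ or to a face of $\mathrm{SSP}(G)$ (i.e. $\mathrm{BQP}_n \le_A \mathrm{SSP}(G)$).
   Context: The Boolean quadratic polytope $\mathrm{BQP}_n$ is the convex hull of the set of vectors $x=(x_{ij})_{1\le i\le j\le n}\in\{0,1\}^{n(n+1)/2}$ satisfying $x_{ij}=x_{ii}x_{jj}$ for all $1\le i<j\le n$. For a graph $G=(V,E)$ with $V=\{v_1,\dots,v_k\}$, the stable set polytope $\mathrm{SSP}(G)$ is the convex hull of $\{y\in\{0,1\}^k : y_i+y_j\le 1 \text{ for every edge }\{v_i,v_j\}\in E\}$. For polytopes $p,q$, we write $p\le_A q$ if $p$ is affinely equivalent (i.e. there is an affine bijection between their affine hulls mapping one onto the other) to $q$ itself or to a face of $q$.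
   Formalization: The polytopes $\mathrm{BQP}_n$ and $\mathrm{SSP}(G)$ are taken over ℚ: their points have rational coordinates, faces come from inequalities with rational coefficients, and the affine equivalence is taken in affine maps with rational coefficients. -}

module Defs where

open import Data.Nat using (ℕ; zero; suc)
open import Data.Fin using (Fin; splitAt; inject₁; fromℕ)
open import Data.Sum using (_⊎_; inj₁; inj₂)
open import Data.Product using (Σ; _×_; _,_; ∃)
open import Data.Bool using (Bool; true; false)
open import Data.Rational using (ℚ; 0ℚ; 1ℚ; _+_; _*_; _≤_)
open import Relation.Binary.PropositionalEquality using (_≡_)
import Data.Product as P

Point : ℕ → Set
Point d = Fin d → ℚ

PSet : ℕ → Set₁
PSet d = Point d → Set

_≈_ : ∀ {d} → Point d → Point d → Set
x ≈ y = ∀ a → x a ≡ y a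

Σℚ : ∀ {m} → (Fin m → ℚ) → ℚ
Σℚ {zero}  f = 0ℚ
Σℚ {suc m} f = f Fin.zero Data.Rational.+ Σℚ (λ i → f (Fin.suc i))
  where import Data.Fin as Fin

dot : ∀ {d} → Point d → Point d → ℚ
dot c x = Σℚ (λ a → c a * x a)

AffHull : ∀ {d} → PSet d → PSet d
AffHull {d} S x = Σ ℕ λ m → Σ (Fin m → Point d) λ p → Σ (Fin m → ℚ) λ λs →
  (∀ i → S (p i)) × (Σℚ λs ≡ 1ℚ) × (∀ a → x a ≡ Σℚ (λ i → λs i * p i a))

Conv : ∀ {d} → PSet d → PSet d
Conv {d} S x = Σ ℕ λ m → Σ (Fin m → Point d) λ p → Σ (Fin m → ℚ) λ λs →
  (∀ i → S (p i)) × (∀ i → 0ℚ ≤ λs i) × (Σℚ λs ≡ 1ℚ)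
  × (∀ a → x a ≡ Σℚ (λ i → λs i * p i a))

record AffineMap (d e : ℕ) : Set where
  field
    A : Fin e → Fin d → ℚ
    b : Fin e → ℚ
  apply : Point d → Point e
  apply x a = Σℚ (λ j → A a j * x j) Data.Rational.+ b a

AffEquiv : ∀ {d e} → PSet d → PSet e → Set
AffEquiv {d} {e} P Q = Σ (AffineMap d e) λ f → let g = AffineMap.apply f in
    (∀ x → AffHull P x → AffHull Q (g x))
  × (∀ x y → AffHull P x → AffHull P y → g x ≈ g y → x ≈ y)
  × (∀ z → AffHull Q z → ∃ λ x → AffHull P x × (g x ≈ z))
  × (∀ x → P x → Q (g x))
  × (∀ z → Q z → ∃ λ x → P x × (g x ≈ z))

IsFace : ∀ {e} → PSet e → PSet e → Set
IsFace {e} Q F = Σ (Point e) λ c → Σ ℚ λ δ →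
    (∀ y → Q y → dot c y ≤ δ)
  × (∀ x → F x → Q x × (dot c x ≡ δ))
  × (∀ x → Q x → dot c x ≡ δ → F x)

_≤A_ : ∀ {d e} → PSet d → PSet e → Set₁
_≤A_ {d} {e} P Q = AffEquiv P Q ⊎ (Σ (PSet e) λ F → IsFace Q F × AffEquiv P F)

Binary : ∀ {d} → Point d → Set
Binary x = ∀ a → (x a ≡ 0ℚ) ⊎ (x a ≡ 1ℚ)

-- coordinates of BQP_n: pairs (i,j) with 1 ≤ i ≤ j ≤ n ; there are tri n = n(n+1)/2
tri : ℕ → ℕ
tri zero = zero
tri (suc n) = tri n Data.Nat.+ suc n

decode : ∀ n → Fin (tri n) → Fin n × Fin n
decode zero ()
decode (suc n) c with splitAt (tri n) c
... | inj₁ c' = P.map inject₁ inject₁ (decode n c')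
... | inj₂ i  = i , fromℕ n

BQPVertex : ∀ n → PSet (tri n)
BQPVertex n x = Binary x ×
  (∀ c c₁ c₂ → P.proj₁ (decode n c) ≡ P.proj₁ (decode n c₁)
             → P.proj₁ (decode n c₁) ≡ P.proj₂ (decode n c₁)
             → P.proj₂ (decode n c) ≡ P.proj₁ (decode n c₂)
             → P.proj₁ (decode n c₂) ≡ P.proj₂ (decode n c₂)
             → x c ≡ x c₁ * x c₂)

BQP : ∀ n → PSet (tri n)
BQP n = Conv (BQPVertex n)

record Graph (k : ℕ) : Set where
  field
    adj    : Fin k → Fin k → Bool
    sym    : ∀ i j → adj i j ≡ adj j i
    irrefl : ∀ i → adj i i ≡ false

SSPVertex : ∀ {k} → Graph k → PSet k
SSPVertex G y = Binary y × (∀ i j → Graph.adj G i j ≡ true → y i + y j ≤ 1ℚ)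

SSP : ∀ {k} → Graph k → PSet k
SSP G = Conv (SSPVertex G)

-- Index the coordinates of BQP_n by the pairs c = (i, j) with i ≤ j, and give the graph two
-- vertices L c and R c per coordinate. The affine map x ↦ y with y(L c) = x_ij and
-- y(R c) = 1 - x_ii if i = j, y(R c) = x_ii - x_ij if i < j, sends the vertices of BQP_n to
-- stable sets for the arcs L c–R c and, when i < j, L c–R ii, L c–R jj, R c–R ii, R c–L jj.
-- The cliques {L c, R c} (i = j) and {L c, R c, R ii} (i < j) sum to a valid inequality of
-- SSP(G) that is tight on the whole image. Conversely, on a stable set where every clique is
-- tight the remaining arcs at L c, R c say x_ij ≤ x_jj and x_ii + x_jj - 1 ≤ x_ij, so on bits
-- x_ij = x_ii x_jj: restricting to the L vertices inverts the map on the vertices of that face.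
-- Since a face of SSP(G) is the convex hull of the vertices on it, the map is an affine
-- isomorphism of BQP_n onto the face.

module Submission where

open import Defs

-- The rational operations are opened only inside this module: the statement at the end uses ℕ.
module _ where

  open import Algebra.Bundles using (CommutativeRing)
  open import Data.Bool using (Bool; true; T; if_then_else_; _∧_; _∨_; not)
  open import Data.Bool.Properties using (T-∧; T-∨; ∨-comm)
  open import Data.Fin as Fin using (Fin; zero; suc; _↑ˡ_; _↑ʳ_; splitAt; join; inject₁; fromℕ)
  open import Data.Fin.Properties
    using ( +↔⊎; splitAt-↑ˡ; splitAt-↑ʳ; splitAt⁻¹-↑ˡ; splitAt⁻¹-↑ʳ; splitAt-join; join-splitAt
          ; inject₁-injective; fromℕ≢inject₁)
  open import Data.Fin.Relation.Unary.Top using (view; ‵fromℕ; ‵inject₁)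
  open import Data.Nat as ℕ using (ℕ; zero; suc)
  open import Data.Product using (Σ; _×_; _,_; ∃; proj₁; proj₂; map)
  open import Data.Product.Properties using (×-≡,≡→≡)
  open import Data.Rational using (ℚ; 0ℚ; 1ℚ; _+_; _*_; _-_; -_; _≤_; _≤ᵇ_; _≟_; nonNegative; ≢-nonZero; 1/_)
  open import Data.Rational.Properties
    using ( +-*-commutativeRing; ≤-refl; ≤-reflexive; ≤-trans; ≤-antisym; <-irrefl; ≮⇒≥; ≤ᵇ⇒≤; ≤⇒≤ᵇ
          ; +-mono-≤; +-mono-<-≤; +-comm; +-identityˡ; +-identityʳ
          ; *-assoc; *-identityˡ; *-zeroˡ; *-distribʳ-+; *-distribˡ-+; *-inverseˡ; *-monoˡ-≤-nonNeg)
  open import Algebra.Properties.Semiring.Sum (CommutativeRing.semiring +-*-commutativeRing)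
    using (sum; sum-cong-≗; sum-replicate-zero; ∑-distrib-+; ∑-comm; *-distribˡ-sum; *-distribʳ-sum)
  open import Data.Rational.Solver using (module +-*-Solver)
  open +-*-Solver using (solve; _:+_; _:*_; _:-_; _:=_; con)
  open import Data.Sum using (_⊎_; inj₁; inj₂; [_,_]′)
  open import Data.Sum.Properties using (inj₂-injective)
  open import Function.Base using (case_of_)
  open import Function.Bundles using (_↔_; Inverse; Equivalence)
  open import Relation.Binary.PropositionalEquality
  open import Relation.Nullary using (Dec; yes; no; ¬_; does; contradiction)
  open import Relation.Nullary.Decidable
    using (isYes; toWitness; fromWitness; decidable-stable; dec-true; dec-false; map′; _⊎-dec_; _×-dec_; ¬?)
  open ≡-Reasoning

  +-mono-≤-≡⇒≡ˡ : ∀ {a b c e} → a ≤ b → c ≤ e → a + c ≡ b + e → a ≡ b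
  +-mono-≤-≡⇒≡ˡ a≤b c≤e a+c≡b+e = ≤-antisym a≤b (≮⇒≥ λ a<b → <-irrefl a+c≡b+e (+-mono-<-≤ a<b c≤e))

  *-monoˡ-≤-≥0 : ∀ {l a b} → 0ℚ ≤ l → a ≤ b → l * a ≤ l * b
  *-monoˡ-≤-≥0 {l} 0≤l = *-monoˡ-≤-nonNeg l {{nonNegative 0≤l}}

  *-cancelˡ-≡ : ∀ {l a b} → l ≢ 0ℚ → l * a ≡ l * b → a ≡ b
  *-cancelˡ-≡ {l} {a} {b} l≢0 la≡lb = let instance _ = ≢-nonZero l≢0 in begin
    a              ≡⟨ *-identityˡ a ⟨
    1ℚ * a         ≡⟨ cong (_* a) (*-inverseˡ l) ⟨
    1/ l * l * a   ≡⟨ *-assoc (1/ l) l a ⟩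
    1/ l * (l * a) ≡⟨ cong (1/ l *_) la≡lb ⟩
    1/ l * (l * b) ≡⟨ *-assoc (1/ l) l b ⟨
    1/ l * l * b   ≡⟨ cong (_* b) (*-inverseˡ l) ⟩
    1ℚ * b         ≡⟨ *-identityˡ b ⟩
    b              ∎

  *-≡-≢⇒zero : ∀ l {a b} → l * a ≡ l * b → a ≢ b → l ≡ 0ℚ
  *-≡-≢⇒zero l la≡lb a≢b = decidable-stable (l ≟ 0ℚ) λ l≢0 → a≢b (*-cancelˡ-≡ l≢0 la≡lb)

  +-≡⇒≡-ˡ : ∀ a {b c} → a + b ≡ c → b ≡ c - a
  +-≡⇒≡-ˡ a {b} {c} a+b≡c = begin
    b           ≡⟨ solve 2 (λ a b → b := a :+ b :- a) refl a b ⟩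
    a + b - a   ≡⟨ cong (_- a) a+b≡c ⟩
    c - a       ∎

  Σℚ≡sum : ∀ {m} (f : Fin m → ℚ) → Σℚ f ≡ sum f
  Σℚ≡sum {zero}  f = refl
  Σℚ≡sum {suc m} f = cong (f zero +_) (Σℚ≡sum (λ i → f (suc i)))

  Σℚ-cong : ∀ {m} {f g : Fin m → ℚ} → f ≗ g → Σℚ f ≡ Σℚ g
  Σℚ-cong {f = f} {g} f≗g rewrite Σℚ≡sum f | Σℚ≡sum g = sum-cong-≗ f≗g

  Σℚ-zero : ∀ m → Σℚ {m} (λ _ → 0ℚ) ≡ 0ℚ
  Σℚ-zero m = trans (Σℚ≡sum {m} (λ _ → 0ℚ)) (sum-replicate-zero m)

  Σℚ-distrib-+ : ∀ {m} (f g : Fin m → ℚ) → Σℚ (λ i → f i + g i) ≡ Σℚ f + Σℚ g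
  Σℚ-distrib-+ f g rewrite Σℚ≡sum f | Σℚ≡sum g | Σℚ≡sum (λ i → f i + g i) = ∑-distrib-+ f g

  *-distribˡ-Σℚ : ∀ {m} r (f : Fin m → ℚ) → r * Σℚ f ≡ Σℚ (λ i → r * f i)
  *-distribˡ-Σℚ r f rewrite Σℚ≡sum f | Σℚ≡sum (λ i → r * f i) = *-distribˡ-sum r f

  *-distribʳ-Σℚ : ∀ {m} r (f : Fin m → ℚ) → Σℚ f * r ≡ Σℚ (λ i → f i * r)
  *-distribʳ-Σℚ r f rewrite Σℚ≡sum f | Σℚ≡sum (λ i → f i * r) = *-distribʳ-sum r f

  Σℚ-comm : ∀ {m n} (f : Fin m → Fin n → ℚ) → Σℚ (λ i → Σℚ (f i)) ≡ Σℚ (λ j → Σℚ (λ i → f i j))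
  Σℚ-comm f = begin
    Σℚ (λ i → Σℚ (f i))              ≡⟨ Σℚ-cong (λ i → Σℚ≡sum (f i)) ⟩
    Σℚ (λ i → sum (f i))             ≡⟨ Σℚ≡sum (λ i → sum (f i)) ⟩
    sum (λ i → sum (f i))            ≡⟨ ∑-comm f ⟩
    sum (λ j → sum (λ i → f i j))    ≡⟨ Σℚ≡sum (λ j → sum (λ i → f i j)) ⟨
    Σℚ (λ j → sum (λ i → f i j))     ≡⟨ Σℚ-cong (λ j → Σℚ≡sum (λ i → f i j)) ⟨
    Σℚ (λ j → Σℚ (λ i → f i j))      ∎

  Σℚ-weighted-const : ∀ {m} (λs : Fin m → ℚ) q → Σℚ λs ≡ 1ℚ → Σℚ (λ i → λs i * q) ≡ q
  Σℚ-weighted-const λs q Σλs≡1 = begin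
    Σℚ (λ i → λs i * q) ≡⟨ *-distribʳ-Σℚ q λs ⟨
    Σℚ λs * q           ≡⟨ cong (_* q) Σλs≡1 ⟩
    1ℚ * q              ≡⟨ *-identityˡ q ⟩
    q                   ∎

  Σℚ-mono-≤ : ∀ {m} {f g : Fin m → ℚ} → (∀ i → f i ≤ g i) → Σℚ f ≤ Σℚ g
  Σℚ-mono-≤ {zero}  f≤g = ≤-refl
  Σℚ-mono-≤ {suc m} f≤g = +-mono-≤ (f≤g zero) (Σℚ-mono-≤ (λ i → f≤g (suc i)))

  Σℚ-mono-≤-≡⇒≗ : ∀ {m} {f g : Fin m → ℚ} → (∀ i → f i ≤ g i) → Σℚ f ≡ Σℚ g → f ≗ g
  Σℚ-mono-≤-≡⇒≗ {suc m} f≤g Σf≡Σg zero = +-mono-≤-≡⇒≡ˡ (f≤g zero) (Σℚ-mono-≤ (λ i → f≤g (suc i))) Σf≡Σg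
  Σℚ-mono-≤-≡⇒≗ {suc m} {f} {g} f≤g Σf≡Σg (suc i) =
    Σℚ-mono-≤-≡⇒≗ (λ i → f≤g (suc i)) tail-eq i
    where
    tail-eq : Σℚ (λ i → f (suc i)) ≡ Σℚ (λ i → g (suc i))
    tail-eq = +-mono-≤-≡⇒≡ˡ (Σℚ-mono-≤ (λ i → f≤g (suc i))) (f≤g zero)
      (trans (+-comm _ (f zero)) (trans Σf≡Σg (+-comm (g zero) _)))

  unit : ∀ {d} → Fin d → Point d
  unit zero    zero    = 1ℚ
  unit zero    (suc _) = 0ℚ
  unit (suc _) zero    = 0ℚ
  unit (suc c) (suc a) = unit c a

  dot-unit : ∀ {d} (c : Fin d) (x : Point d) → dot (unit c) x ≡ x c
  dot-unit {suc d} zero x = begin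
    1ℚ * x zero + Σℚ (λ a → 0ℚ * x (suc a)) ≡⟨ cong₂ _+_ (*-identityˡ (x zero)) (Σℚ-cong (λ a → *-zeroˡ (x (suc a)))) ⟩
    x zero + Σℚ {d} (λ _ → 0ℚ)               ≡⟨ cong (x zero +_) (Σℚ-zero d) ⟩
    x zero + 0ℚ                              ≡⟨ +-identityʳ (x zero) ⟩
    x zero                                   ∎
  dot-unit (suc c) x = begin
    0ℚ * x zero + dot (unit c) (λ a → x (suc a)) ≡⟨ cong₂ _+_ (*-zeroˡ (x zero)) (dot-unit c (λ a → x (suc a))) ⟩
    0ℚ + x (suc c)                               ≡⟨ +-identityˡ (x (suc c)) ⟩
    x (suc c)                                    ∎

  dot-+ˡ : ∀ {d} (u v x : Point d) → dot (λ a → u a + v a) x ≡ dot u x + dot v x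
  dot-+ˡ u v x =
    trans (Σℚ-cong (λ a → *-distribʳ-+ (x a) (u a) (v a))) (Σℚ-distrib-+ (λ a → u a * x a) (λ a → v a * x a))

  dot-*ˡ : ∀ {d} r (u x : Point d) → dot (λ a → r * u a) x ≡ r * dot u x
  dot-*ˡ r u x = trans (Σℚ-cong (λ a → *-assoc r (u a) (x a))) (sym (*-distribˡ-Σℚ r (λ a → u a * x a)))

  dot-*-unit : ∀ {d} r (c : Fin d) (x : Point d) → dot (λ a → r * unit c a) x ≡ r * x c
  dot-*-unit r c x = trans (dot-*ˡ r (unit c) x) (cong (r *_) (dot-unit c x))

  dot-Σˡ : ∀ {d m} (w : Fin m → Point d) (x : Point d) →
           dot (λ a → Σℚ (λ c → w c a)) x ≡ Σℚ (λ c → dot (w c) x)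
  dot-Σˡ w x = begin
    Σℚ (λ a → Σℚ (λ c → w c a) * x a)   ≡⟨ Σℚ-cong (λ a → *-distribʳ-Σℚ (x a) (λ c → w c a)) ⟩
    Σℚ (λ a → Σℚ (λ c → w c a * x a))   ≡⟨ Σℚ-comm (λ a c → w c a * x a) ⟩
    Σℚ (λ c → dot (w c) x)              ∎

  dot-combination : ∀ {d m} (w : Point d) (λs : Fin m → ℚ) (p : Fin m → Point d) {x : Point d} →
                    x ≈ (λ a → Σℚ (λ i → λs i * p i a)) → dot w x ≡ Σℚ (λ i → λs i * dot w (p i))
  dot-combination w λs p {x} x≈ = begin
    Σℚ (λ a → w a * x a)
      ≡⟨ Σℚ-cong (λ a → trans (cong (w a *_) (x≈ a)) (*-distribˡ-Σℚ (w a) (λ i → λs i * p i a))) ⟩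
    Σℚ (λ a → Σℚ (λ i → w a * (λs i * p i a))) ≡⟨ Σℚ-comm (λ a i → w a * (λs i * p i a)) ⟩
    Σℚ (λ i → Σℚ (λ a → w a * (λs i * p i a))) ≡⟨ Σℚ-cong (λ i → Σℚ-cong (λ a → swap (w a) (λs i) (p i a))) ⟩
    Σℚ (λ i → Σℚ (λ a → λs i * (w a * p i a))) ≡⟨ Σℚ-cong (λ i → *-distribˡ-Σℚ (λs i) (λ a → w a * p i a)) ⟨
    Σℚ (λ i → λs i * dot w (p i))              ∎
    where
    swap : ∀ u v t → u * (v * t) ≡ v * (u * t)
    swap = solve 3 (λ u v t → u :* (v :* t) := v :* (u :* t)) refl

  module _ {d e} (f : AffineMap d e) where
    open AffineMap f using (A; b; apply)

    apply-combination : ∀ {m} (λs : Fin m → ℚ) (p : Fin m → Point d) {x : Point d} → Σℚ λs ≡ 1ℚ →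
                        x ≈ (λ a → Σℚ (λ i → λs i * p i a)) →
                        apply x ≈ (λ a → Σℚ (λ i → λs i * apply (p i) a))
    apply-combination λs p {x} Σλs≡1 x≈ a = begin
      dot (A a) x + b a
        ≡⟨ cong₂ _+_ (dot-combination (A a) λs p x≈) (sym (Σℚ-weighted-const λs (b a) Σλs≡1)) ⟩
      Σℚ (λ i → λs i * dot (A a) (p i)) + Σℚ (λ i → λs i * b a)
        ≡⟨ Σℚ-distrib-+ (λ i → λs i * dot (A a) (p i)) (λ i → λs i * b a) ⟨
      Σℚ (λ i → λs i * dot (A a) (p i) + λs i * b a)
        ≡⟨ Σℚ-cong (λ i → *-distribˡ-+ (λs i) (dot (A a) (p i)) (b a)) ⟨
      Σℚ (λ i → λs i * apply (p i) a) ∎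

    module _ {P : PSet d} {Q : PSet e} where

      AffHull-image : (∀ x → P x → Q (apply x)) → ∀ x → AffHull P x → AffHull Q (apply x)
      AffHull-image P⇒Q x (m , p , λs , Pp , Σλs≡1 , x≈) =
        m , (λ i → apply (p i)) , λs , (λ i → P⇒Q (p i) (Pp i)) , Σλs≡1 , apply-combination λs p Σλs≡1 x≈

      Conv-image : (∀ x → P x → Q (apply x)) → ∀ x → Conv P x → Conv Q (apply x)
      Conv-image P⇒Q x (m , p , λs , Pp , λs≥0 , Σλs≡1 , x≈) =
        m , (λ i → apply (p i)) , λs , (λ i → P⇒Q (p i) (Pp i)) , λs≥0 , Σλs≡1 , apply-combination λs p Σλs≡1 x≈

      module _ (lift : ∀ z → Q z → ∃ λ x → P x × apply x ≈ z) {m} {q : Fin m → Point e} (Qq : ∀ i → Q (q i)) where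

        liftᵢ : Fin m → Point d
        liftᵢ i = proj₁ (lift (q i) (Qq i))

        liftᵢ-∈ : ∀ i → P (liftᵢ i)
        liftᵢ-∈ i = proj₁ (proj₂ (lift (q i) (Qq i)))

        apply-lift-combination : (λs : Fin m → ℚ) → Σℚ λs ≡ 1ℚ →
                                 apply (λ a → Σℚ (λ i → λs i * liftᵢ i a)) ≈ (λ a → Σℚ (λ i → λs i * q i a))
        apply-lift-combination λs Σλs≡1 a =
          trans (apply-combination λs liftᵢ Σλs≡1 (λ _ → refl) a)
                (Σℚ-cong (λ i → cong (λs i *_) (proj₂ (proj₂ (lift (q i) (Qq i))) a)))

      AffHull-preimage : (∀ z → Q z → ∃ λ x → P x × apply x ≈ z) →
                         ∀ z → AffHull Q z → ∃ λ x → AffHull P x × apply x ≈ z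
      AffHull-preimage lift z (m , q , λs , Qq , Σλs≡1 , z≈) =
        (λ a → Σℚ (λ i → λs i * liftᵢ lift Qq i a)) ,
        (m , liftᵢ lift Qq , λs , liftᵢ-∈ lift Qq , Σλs≡1 , λ _ → refl) ,
        λ a → trans (apply-lift-combination lift Qq λs Σλs≡1 a) (sym (z≈ a))

      Conv-preimage : (∀ z → Q z → ∃ λ x → P x × apply x ≈ z) →
                      ∀ z → Conv Q z → ∃ λ x → Conv P x × apply x ≈ z
      Conv-preimage lift z (m , q , λs , Qq , λs≥0 , Σλs≡1 , z≈) =
        (λ a → Σℚ (λ i → λs i * liftᵢ lift Qq i a)) ,
        (m , liftᵢ lift Qq , λs , liftᵢ-∈ lift Qq , λs≥0 , Σλs≡1 , λ _ → refl) ,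
        λ a → trans (apply-lift-combination lift Qq λs Σλs≡1 a) (sym (z≈ a))

  affEquiv : ∀ {d e} {P : PSet d} {Q : PSet e} (f : AffineMap d e) → let open AffineMap f in
             (∀ x y → apply x ≈ apply y → x ≈ y) →
             (∀ x → P x → Q (apply x)) →
             (∀ z → Q z → ∃ λ x → P x × apply x ≈ z) →
             AffEquiv P Q
  affEquiv {P = P} {Q} f injective P⇒Q lift =
    f , AffHull-image f {P} {Q} P⇒Q , (λ x y _ _ → injective x y) , AffHull-preimage f {P} {Q} lift , P⇒Q , lift

  module _ {d} {S : PSet d} (w : Point d) (δ : ℚ) (valid : ∀ y → S y → dot w y ≤ δ) where

    private
      weighted-≤ : ∀ {m} (λs : Fin m → ℚ) (p : Fin m → Point d) → (∀ i → 0ℚ ≤ λs i) → (∀ i → S (p i)) →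
                   ∀ i → λs i * dot w (p i) ≤ λs i * δ
      weighted-≤ λs p λs≥0 Sp i = *-monoˡ-≤-≥0 (λs≥0 i) (valid (p i) (Sp i))

    Conv-valid : ∀ y → Conv S y → dot w y ≤ δ
    Conv-valid y (m , p , λs , Sp , λs≥0 , Σλs≡1 , y≈) =
      ≤-trans (≤-reflexive (dot-combination w λs p y≈))
        (≤-trans (Σℚ-mono-≤ (weighted-≤ λs p λs≥0 Sp)) (≤-reflexive (Σℚ-weighted-const λs δ Σλs≡1)))

    Conv-face : IsFace (Conv S) (λ z → Conv S z × dot w z ≡ δ)
    Conv-face = w , δ , Conv-valid , (λ _ Fz → Fz) , λ _ Cz w·z≡δ → Cz , w·z≡δ

    Conv-tight : ∀ {t} → S t → dot w t ≡ δ →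
                 ∀ z → Conv S z → dot w z ≡ δ → Conv (λ y → S y × dot w y ≡ δ) z
    Conv-tight {t} St w·t≡δ z (m , p , λs , Sp , λs≥0 , Σλs≡1 , z≈) w·z≡δ =
      m , (λ i → proj₁ (tightened i)) , λs , (λ i → proj₁ (proj₂ (tightened i))) , λs≥0 , Σλs≡1 ,
      λ a → trans (z≈ a) (Σℚ-cong (λ i → sym (proj₂ (proj₂ (tightened i)) a)))
      where
      λw·p≡λδ : ∀ i → λs i * dot w (p i) ≡ λs i * δ
      λw·p≡λδ = Σℚ-mono-≤-≡⇒≗ (weighted-≤ λs p λs≥0 Sp)
        (trans (sym (dot-combination w λs p z≈)) (trans w·z≡δ (sym (Σℚ-weighted-const λs δ Σλs≡1))))

      -- a vertex off the face carries weight 0, so it may be replaced by t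
      tightened : ∀ i → Σ (Point d) λ q → (S q × dot w q ≡ δ) × (∀ a → λs i * q a ≡ λs i * p i a)
      tightened i with dot w (p i) ≟ δ
      ... | yes w·p≡δ = p i , (Sp i , w·p≡δ) , λ _ → refl
      ... | no  w·p≢δ = t , (St , w·t≡δ) , λ a →
        subst (λ l → l * t a ≡ l * p i a) (sym (*-≡-≢⇒zero (λs i) (λw·p≡λδ i) w·p≢δ))
              (trans (*-zeroˡ (t a)) (sym (*-zeroˡ (p i a))))

  IsBit : ℚ → Set
  IsBit q = q ≡ 0ℚ ⊎ q ≡ 1ℚ

  _==_ : ℚ → ℚ → Bool
  p == q = isYes (p ≟ q)

  _⇒ᵇ_ : Bool → Bool → Bool
  p ⇒ᵇ q = not p ∨ q

  infix  4 _==_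
  infixr 1 _⇒ᵇ_

  ==⇒≡ : ∀ {p q} → T (p == q) → p ≡ q
  ==⇒≡ {p} {q} = toWitness {a? = p ≟ q}

  ≡⇒== : ∀ {p q} → p ≡ q → T (p == q)
  ≡⇒== {p} {q} = fromWitness {a? = p ≟ q}

  ⇒ᵇ-elim : ∀ {p q} → T (p ⇒ᵇ q) → T p → T q
  ⇒ᵇ-elim {true} t _ = t

  ∧-intro : ∀ {p q} → T p → T q → T (p ∧ q)
  ∧-intro tp tq = Equivalence.from T-∧ (tp , tq)

  bitᵇ : ℚ → Bool
  bitᵇ q = (q == 0ℚ) ∨ (q == 1ℚ)

  bitᵇ⇒IsBit : ∀ {q} → T (bitᵇ q) → IsBit q
  bitᵇ⇒IsBit {q} t with Equivalence.to (T-∨ {q == 0ℚ}) t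
  ... | inj₁ t₀ = inj₁ (==⇒≡ t₀)
  ... | inj₂ t₁ = inj₂ (==⇒≡ t₁)

  -- A Boolean test holds at every bit once it holds at 0 and at 1; nesting this decides
  -- statements about several bits by evaluating them at all corners of the cube.
  everyBit : (ℚ → Bool) → Bool
  everyBit P = P 0ℚ ∧ P 1ℚ

  at-bit : ∀ (P : ℚ → Bool) → T (everyBit P) → ∀ {a} → IsBit a → T (P a)
  at-bit P t (inj₁ refl) = proj₁ (Equivalence.to T-∧ t)
  at-bit P t (inj₂ refl) = proj₂ (Equivalence.to T-∧ t)

  at-bits₂ : ∀ (P : ℚ → ℚ → Bool) → T (everyBit λ a → everyBit (P a)) →
             ∀ {a b} → IsBit a → IsBit b → T (P a b)
  at-bits₂ P t ha hb = at-bit (P _) (at-bit (λ a → everyBit (P a)) t ha) hb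

  at-bits₃ : ∀ (P : ℚ → ℚ → ℚ → Bool) → T (everyBit λ a → everyBit λ b → everyBit (P a b)) →
             ∀ {a b c} → IsBit a → IsBit b → IsBit c → T (P a b c)
  at-bits₃ P t ha hb hc = at-bit (P _ _) (at-bits₂ (λ a b → everyBit (P a b)) t ha hb) hc

  at-bits₄ : ∀ (P : ℚ → ℚ → ℚ → ℚ → Bool) →
             T (everyBit λ a → everyBit λ b → everyBit λ c → everyBit (P a b c)) →
             ∀ {a b c e} → IsBit a → IsBit b → IsBit c → IsBit e → T (P a b c e)
  at-bits₄ P t ha hb hc he = at-bit (P _ _ _) (at-bits₃ (λ a b c → everyBit (P a b c)) t ha hb hc) he

  module _ {a : ℚ} (ha : IsBit a) where

    bit-complement : IsBit (1ℚ - a)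
    bit-complement = bitᵇ⇒IsBit (at-bit (λ a → bitᵇ (1ℚ - a)) _ ha)

    bit-idempotent : a ≡ a * a
    bit-idempotent = ==⇒≡ (at-bit (λ a → a == a * a) _ ha)

    bit-complement-≤ : a + (1ℚ - a) ≤ 1ℚ
    bit-complement-≤ = ≤ᵇ⇒≤ (at-bit (λ a → a + (1ℚ - a) ≤ᵇ 1ℚ) _ ha)

  module _ {a b : ℚ} (ha : IsBit a) (hb : IsBit b) where

    bit-difference : IsBit (a - a * b)
    bit-difference = bitᵇ⇒IsBit (at-bits₂ (λ a b → bitᵇ (a - a * b)) _ ha hb)

    product-difference-≤ : a * b + (a - a * b) ≤ 1ℚ
    product-difference-≤ = ≤ᵇ⇒≤ (at-bits₂ (λ a b → a * b + (a - a * b) ≤ᵇ 1ℚ) _ ha hb)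

    product-complementˡ-≤ : a * b + (1ℚ - a) ≤ 1ℚ
    product-complementˡ-≤ = ≤ᵇ⇒≤ (at-bits₂ (λ a b → a * b + (1ℚ - a) ≤ᵇ 1ℚ) _ ha hb)

    product-complementʳ-≤ : a * b + (1ℚ - b) ≤ 1ℚ
    product-complementʳ-≤ = ≤ᵇ⇒≤ (at-bits₂ (λ a b → a * b + (1ℚ - b) ≤ᵇ 1ℚ) _ ha hb)

    difference-complement-≤ : a - a * b + (1ℚ - a) ≤ 1ℚ
    difference-complement-≤ = ≤ᵇ⇒≤ (at-bits₂ (λ a b → a - a * b + (1ℚ - a) ≤ᵇ 1ℚ) _ ha hb)

    difference-+-≤ : a - a * b + b ≤ 1ℚ
    difference-+-≤ = ≤ᵇ⇒≤ (at-bits₂ (λ a b → a - a * b + b ≤ᵇ 1ℚ) _ ha hb)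

  bits-pairwise-≤⇒≤ : ∀ {a b c} → IsBit a → IsBit b → IsBit c →
                      a + b ≤ 1ℚ → a + c ≤ 1ℚ → b + c ≤ 1ℚ → a + b + c ≤ 1ℚ
  bits-pairwise-≤⇒≤ ha hb hc ab ac bc = ≤ᵇ⇒≤ (⇒ᵇ-elim
    (at-bits₃ (λ a b c → (a + b ≤ᵇ 1ℚ) ∧ (a + c ≤ᵇ 1ℚ) ∧ (b + c ≤ᵇ 1ℚ) ⇒ᵇ a + b + c ≤ᵇ 1ℚ) _ ha hb hc)
    (∧-intro (≤⇒≤ᵇ ab) (∧-intro (≤⇒≤ᵇ ac) (≤⇒≤ᵇ bc))))

  -- With v = a - u the hypotheses are the McCormick inequalities u ≤ b and a + b - 1 ≤ u,
  -- which force u = a b on bits.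
  mcCormick : ∀ {a b u v} → IsBit a → IsBit b → IsBit u → IsBit v →
              u + v + (1ℚ - a) ≡ 1ℚ → u + (1ℚ - b) ≤ 1ℚ → v + b ≤ 1ℚ → u ≡ a * b
  mcCormick ha hb hu hv u+v+ā≡1 u+b̄≤1 v+b≤1 = ==⇒≡ (⇒ᵇ-elim
    (at-bits₄ (λ a b u v → (u + v + (1ℚ - a) == 1ℚ) ∧ (u + (1ℚ - b) ≤ᵇ 1ℚ) ∧ (v + b ≤ᵇ 1ℚ) ⇒ᵇ u == a * b) _ ha hb hu hv)
    (∧-intro (≡⇒== u+v+ā≡1) (∧-intro (≤⇒≤ᵇ u+b̄≤1) (≤⇒≤ᵇ v+b≤1))))

  does≡true⇒ : ∀ {A : Set} (a? : Dec A) → does a? ≡ true → A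
  does≡true⇒ (yes a) _ = a

  module ArcGraph {k} {V : Set} (enc : Fin k ↔ V) (Arc : V → V → Set)
                  (arc? : ∀ u v → Dec (Arc u v)) (arc-irrefl : ∀ {u} → ¬ Arc u u) where
    open Inverse enc using (to; from; strictlyInverseˡ; strictlyInverseʳ)

    adjacent : Fin k → Fin k → Bool
    adjacent i j = does (arc? (to i) (to j) ⊎-dec arc? (to j) (to i))

    graph : Graph k
    graph = record
      { adj    = adjacent
      ; sym    = λ i j → ∨-comm (does (arc? (to i) (to j))) (does (arc? (to j) (to i)))
      ; irrefl = λ i → dec-false (arc? (to i) (to i) ⊎-dec arc? (to i) (to i)) [ arc-irrefl , arc-irrefl ]′
      }

    arc-≤ : ∀ {y u v} → SSPVertex graph y → Arc u v → y (from u) + y (from v) ≤ 1ℚ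
    arc-≤ {u = u} {v} (_ , stable) a = stable (from u) (from v)
      (dec-true (arc? (to (from u)) (to (from v)) ⊎-dec arc? (to (from v)) (to (from u)))
                (inj₁ (subst₂ Arc (sym (strictlyInverseˡ u)) (sym (strictlyInverseˡ v)) a)))

    arcs-≤⇒stable : ∀ {y} → Binary y → (∀ {u v} → Arc u v → y (from u) + y (from v) ≤ 1ℚ) → SSPVertex graph y
    arcs-≤⇒stable {y} bits arcs-≤ = bits , λ i j ij →
      [ forward i j , backward i j ]′ (does≡true⇒ (arc? (to i) (to j) ⊎-dec arc? (to j) (to i)) ij)
      where
      forward : ∀ i j → Arc (to i) (to j) → y i + y j ≤ 1ℚ
      forward i j a = subst₂ (λ i j → y i + y j ≤ 1ℚ) (strictlyInverseʳ i) (strictlyInverseʳ j) (arcs-≤ a)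
      backward : ∀ i j → Arc (to j) (to i) → y i + y j ≤ 1ℚ
      backward i j a = ≤-trans (≤-reflexive (+-comm (y i) (y j))) (forward j i a)

  diag : ∀ n → Fin n → Fin (tri n)
  diag (suc n) i with view i
  ... | ‵fromℕ     = tri n ↑ʳ fromℕ n
  ... | ‵inject₁ j = diag n j ↑ˡ suc n

  decode-↑ˡ : ∀ n (c : Fin (tri n)) → decode (suc n) (c ↑ˡ suc n) ≡ map inject₁ inject₁ (decode n c)
  decode-↑ˡ n c rewrite splitAt-↑ˡ (tri n) c (suc n) = refl

  decode-↑ʳ : ∀ n (i : Fin (suc n)) → decode (suc n) (tri n ↑ʳ i) ≡ (i , fromℕ n)
  decode-↑ʳ n i rewrite splitAt-↑ʳ (tri n) (suc n) i = refl

  decode-diag : ∀ n (i : Fin n) → decode n (diag n i) ≡ (i , i)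
  decode-diag (suc n) i with view i
  ... | ‵fromℕ     = decode-↑ʳ n (fromℕ n)
  ... | ‵inject₁ j = trans (decode-↑ˡ n (diag n j)) (cong (map inject₁ inject₁) (decode-diag n j))

  decode-injective : ∀ n {c c′ : Fin (tri n)} → decode n c ≡ decode n c′ → c ≡ c′
  decode-injective (suc n) {c} {c′} eq with splitAt (tri n) c in c≡ | splitAt (tri n) c′ in c′≡
  ... | inj₁ a | inj₁ a′ = begin
    c           ≡⟨ splitAt⁻¹-↑ˡ c≡ ⟨
    a ↑ˡ suc n  ≡⟨ cong (_↑ˡ suc n) (decode-injective n (×-≡,≡→≡ (inject₁-injective (cong proj₁ eq) ,
                                                                 inject₁-injective (cong proj₂ eq)))) ⟩
    a′ ↑ˡ suc n ≡⟨ splitAt⁻¹-↑ˡ c′≡ ⟩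
    c′          ∎
  ... | inj₁ a | inj₂ i′ = contradiction (sym (cong proj₂ eq)) fromℕ≢inject₁
  ... | inj₂ i | inj₁ a′ = contradiction (cong proj₂ eq) fromℕ≢inject₁
  ... | inj₂ i | inj₂ i′ = trans (sym (splitAt⁻¹-↑ʳ c≡)) (trans (cong (tri n ↑ʳ_) (cong proj₁ eq)) (splitAt⁻¹-↑ʳ c′≡))

  diag-unique : ∀ n {c : Fin (tri n)} {i} → proj₁ (decode n c) ≡ proj₂ (decode n c) → proj₁ (decode n c) ≡ i →
                c ≡ diag n i
  diag-unique n {c} {i} diagonal first≡i =
    decode-injective n (trans (×-≡,≡→≡ (first≡i , trans (sym diagonal) first≡i)) (sym (decode-diag n i)))

  module Construction (n : ℕ) where

    Coord : Set
    Coord = Fin (tri n)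

    Side : Set
    Side = Coord ⊎ Coord

    pattern L c = inj₁ c
    pattern R c = inj₂ c

    ⟨_⟩ : Side → Fin (tri n ℕ.+ tri n)
    ⟨_⟩ = join (tri n) (tri n)

    first second : Coord → Fin n
    first c  = proj₁ (decode n c)
    second c = proj₂ (decode n c)

    IsDiagonal : Coord → Set
    IsDiagonal c = first c ≡ second c

    diagonal? : ∀ c → Dec (IsDiagonal c)
    diagonal? c = first c Fin.≟ second c

    ii jj : Coord → Coord
    ii c = diag n (first c)
    jj c = diag n (second c)

    first-ii : ∀ c → first (ii c) ≡ first c
    first-ii c = cong proj₁ (decode-diag n (first c))

    first-jj : ∀ c → first (jj c) ≡ second c
    first-jj c = cong proj₁ (decode-diag n (second c))

    diag-diagonal : ∀ i → IsDiagonal (diag n i)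
    diag-diagonal i = trans (cong proj₁ (decode-diag n i)) (sym (cong proj₂ (decode-diag n i)))

    ii-diagonal : ∀ c → IsDiagonal (ii c)
    ii-diagonal c = diag-diagonal (first c)

    jj-diagonal : ∀ c → IsDiagonal (jj c)
    jj-diagonal c = diag-diagonal (second c)

    diagonal⇒ii≡ : ∀ {c} → IsDiagonal c → ii c ≡ c
    diagonal⇒ii≡ diagonal = sym (diag-unique n diagonal refl)

    diagonal⇒jj≡ : ∀ {c} → IsDiagonal c → jj c ≡ c
    diagonal⇒jj≡ diagonal = sym (diag-unique n diagonal diagonal)

    BQPVertex⇒product : ∀ {x} → BQPVertex n x → ∀ c → x c ≡ x (ii c) * x (jj c)
    BQPVertex⇒product (_ , product) c = product c (ii c) (jj c)
      (sym (first-ii c)) (ii-diagonal c) (sym (first-jj c)) (jj-diagonal c)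

    product⇒BQPVertex : ∀ {x} → Binary x → (∀ c → x c ≡ x (ii c) * x (jj c)) → BQPVertex n x
    product⇒BQPVertex {x} bits product = bits , λ c c₁ c₂ first≡ diagonal₁ second≡ diagonal₂ →
      trans (product c) (sym (cong₂ (λ s t → x s * x t)
        (diag-unique n diagonal₁ (sym first≡)) (diag-unique n diagonal₂ (sym second≡))))

    data Arc : Side → Side → Set where
      L-R   : ∀ c → Arc (L c) (R c)
      L-Rii : ∀ {c} → ¬ IsDiagonal c → Arc (L c) (R (ii c))
      L-Rjj : ∀ {c} → ¬ IsDiagonal c → Arc (L c) (R (jj c))
      R-Rii : ∀ {c} → ¬ IsDiagonal c → Arc (R c) (R (ii c))
      R-Ljj : ∀ {c} → ¬ IsDiagonal c → Arc (R c) (L (jj c))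

    arc? : ∀ u v → Dec (Arc u v)
    arc? (L c) (L c′) = no λ ()
    arc? (L c) (R c′) =
      map′ to from ((c Fin.≟ c′) ⊎-dec (¬? (diagonal? c) ×-dec ((c′ Fin.≟ ii c) ⊎-dec (c′ Fin.≟ jj c))))
      where
      to : c ≡ c′ ⊎ (¬ IsDiagonal c × (c′ ≡ ii c ⊎ c′ ≡ jj c)) → Arc (L c) (R c′)
      to (inj₁ refl)                = L-R c
      to (inj₂ (off , inj₁ refl)) = L-Rii off
      to (inj₂ (off , inj₂ refl)) = L-Rjj off
      from : Arc (L c) (R c′) → c ≡ c′ ⊎ (¬ IsDiagonal c × (c′ ≡ ii c ⊎ c′ ≡ jj c))
      from (L-R c)     = inj₁ refl
      from (L-Rii off) = inj₂ (off , inj₁ refl)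
      from (L-Rjj off) = inj₂ (off , inj₂ refl)
    arc? (R c) (R c′) = map′ to from (¬? (diagonal? c) ×-dec (c′ Fin.≟ ii c))
      where
      to : ¬ IsDiagonal c × c′ ≡ ii c → Arc (R c) (R c′)
      to (off , refl) = R-Rii off
      from : Arc (R c) (R c′) → ¬ IsDiagonal c × c′ ≡ ii c
      from (R-Rii off) = off , refl
    arc? (R c) (L c′) = map′ to from (¬? (diagonal? c) ×-dec (c′ Fin.≟ jj c))
      where
      to : ¬ IsDiagonal c × c′ ≡ jj c → Arc (R c) (L c′)
      to (off , refl) = R-Ljj off
      from : Arc (R c) (L c′) → ¬ IsDiagonal c × c′ ≡ jj c
      from (R-Ljj off) = off , refl

    arc⇒≢ : ∀ {u v} → Arc u v → u ≢ v
    arc⇒≢ (L-R c)     ()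
    arc⇒≢ (L-Rii off) ()
    arc⇒≢ (L-Rjj off) ()
    arc⇒≢ (R-Rii {c} off) c≡ii = off (subst IsDiagonal (sym (inj₂-injective c≡ii)) (ii-diagonal c))
    arc⇒≢ (R-Ljj off) ()

    open ArcGraph +↔⊎ Arc arc? (λ a → arc⇒≢ a refl) using (graph; arc-≤; arcs-≤⇒stable)

    G : Graph (tri n ℕ.+ tri n)
    G = graph

    every-side : ∀ {P : Fin (tri n ℕ.+ tri n) → Set} → (∀ u → P ⟨ u ⟩) → ∀ v → P v
    every-side {P} P⟨⟩ v = subst P (join-splitAt (tri n) (tri n) v) (P⟨⟩ (splitAt (tri n) v))

    byDiagonal : ∀ {A : Set} → Coord → A → A → A
    byDiagonal c a b = if does (diagonal? c) then a else b

    byDiagonal-diagonal : ∀ {A : Set} {c} {a b : A} → IsDiagonal c → byDiagonal c a b ≡ a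
    byDiagonal-diagonal {c = c} {a} {b} diagonal = cong (λ t → if t then a else b) (dec-true (diagonal? c) diagonal)

    byDiagonal-offDiagonal : ∀ {A : Set} {c} {a b : A} → ¬ IsDiagonal c → byDiagonal c a b ≡ b
    byDiagonal-offDiagonal {c = c} {a} {b} off = cong (λ t → if t then a else b) (dec-false (diagonal? c) off)

    row : Side → Point (tri n)
    row (L c) = unit c
    row (R c) = byDiagonal c (λ a → - 1ℚ * unit c a) (λ a → unit (ii c) a + - 1ℚ * unit c a)

    offset : Side → ℚ
    offset (L c) = 0ℚ
    offset (R c) = byDiagonal c 1ℚ 0ℚ

    embedding : AffineMap (tri n) (tri n ℕ.+ tri n)
    embedding = record { A = λ v → row (splitAt (tri n) v) ; b = λ v → offset (splitAt (tri n) v) }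

    embed : Point (tri n) → Point (tri n ℕ.+ tri n)
    embed = AffineMap.apply embedding

    embed-⟨⟩ : ∀ x u → embed x ⟨ u ⟩ ≡ dot (row u) x + offset u
    embed-⟨⟩ x u = cong (λ w → dot (row w) x + offset w) (splitAt-join (tri n) (tri n) u)

    embed-L : ∀ x c → embed x ⟨ L c ⟩ ≡ x c
    embed-L x c = trans (embed-⟨⟩ x (L c)) (trans (+-identityʳ _) (dot-unit c x))

    embed-R-diagonal : ∀ x {c} → IsDiagonal c → embed x ⟨ R c ⟩ ≡ 1ℚ - x c
    embed-R-diagonal x {c} diagonal = begin
      embed x ⟨ R c ⟩                       ≡⟨ embed-⟨⟩ x (R c) ⟩
      dot (row (R c)) x + offset (R c)
        ≡⟨ cong₂ (λ r o → dot r x + o) (byDiagonal-diagonal diagonal) (byDiagonal-diagonal diagonal) ⟩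
      dot (λ a → - 1ℚ * unit c a) x + 1ℚ    ≡⟨ cong (_+ 1ℚ) (dot-*-unit (- 1ℚ) c x) ⟩
      - 1ℚ * x c + 1ℚ                       ≡⟨ solve 1 (λ u → con (- 1ℚ) :* u :+ con 1ℚ := con 1ℚ :- u) refl (x c) ⟩
      1ℚ - x c                              ∎

    embed-R-offDiagonal : ∀ x {c} → ¬ IsDiagonal c → embed x ⟨ R c ⟩ ≡ x (ii c) - x c
    embed-R-offDiagonal x {c} off = begin
      embed x ⟨ R c ⟩                                       ≡⟨ embed-⟨⟩ x (R c) ⟩
      dot (row (R c)) x + offset (R c)
        ≡⟨ cong₂ (λ r o → dot r x + o) (byDiagonal-offDiagonal off) (byDiagonal-offDiagonal off) ⟩
      dot (λ a → unit (ii c) a + - 1ℚ * unit c a) x + 0ℚ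
        ≡⟨ cong (_+ 0ℚ) (dot-+ˡ (unit (ii c)) (λ a → - 1ℚ * unit c a) x) ⟩
      dot (unit (ii c)) x + dot (λ a → - 1ℚ * unit c a) x + 0ℚ
        ≡⟨ cong (λ s → dot (unit (ii c)) x + s + 0ℚ) (dot-*-unit (- 1ℚ) c x) ⟩
      dot (unit (ii c)) x + - 1ℚ * x c + 0ℚ                ≡⟨ cong (λ s → s + - 1ℚ * x c + 0ℚ) (dot-unit (ii c) x) ⟩
      x (ii c) + - 1ℚ * x c + 0ℚ
        ≡⟨ solve 2 (λ u v → u :+ con (- 1ℚ) :* v :+ con 0ℚ := u :- v) refl (x (ii c)) (x c) ⟩
      x (ii c) - x c                                        ∎

    clique : Coord → Point (tri n ℕ.+ tri n)
    clique c = byDiagonal c (λ v → unit ⟨ L c ⟩ v + unit ⟨ R c ⟩ v)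
                            (λ v → unit ⟨ L c ⟩ v + unit ⟨ R c ⟩ v + unit ⟨ R (ii c) ⟩ v)

    clique-diagonal : ∀ y {c} → IsDiagonal c → dot (clique c) y ≡ y ⟨ L c ⟩ + y ⟨ R c ⟩
    clique-diagonal y {c} diagonal = begin
      dot (clique c) y                              ≡⟨ cong (λ w → dot w y) (byDiagonal-diagonal diagonal) ⟩
      dot (λ v → unit ⟨ L c ⟩ v + unit ⟨ R c ⟩ v) y ≡⟨ dot-+ˡ (unit ⟨ L c ⟩) (unit ⟨ R c ⟩) y ⟩
      dot (unit ⟨ L c ⟩) y + dot (unit ⟨ R c ⟩) y   ≡⟨ cong₂ _+_ (dot-unit ⟨ L c ⟩ y) (dot-unit ⟨ R c ⟩ y) ⟩
      y ⟨ L c ⟩ + y ⟨ R c ⟩                         ∎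

    clique-offDiagonal : ∀ y {c} → ¬ IsDiagonal c → dot (clique c) y ≡ y ⟨ L c ⟩ + y ⟨ R c ⟩ + y ⟨ R (ii c) ⟩
    clique-offDiagonal y {c} off = begin
      dot (clique c) y
        ≡⟨ cong (λ w → dot w y) (byDiagonal-offDiagonal off) ⟩
      dot (λ v → unit ⟨ L c ⟩ v + unit ⟨ R c ⟩ v + unit ⟨ R (ii c) ⟩ v) y
        ≡⟨ dot-+ˡ (λ v → unit ⟨ L c ⟩ v + unit ⟨ R c ⟩ v) (unit ⟨ R (ii c) ⟩) y ⟩
      dot (λ v → unit ⟨ L c ⟩ v + unit ⟨ R c ⟩ v) y + dot (unit ⟨ R (ii c) ⟩) y
        ≡⟨ cong₂ _+_ (dot-+ˡ (unit ⟨ L c ⟩) (unit ⟨ R c ⟩) y) (dot-unit ⟨ R (ii c) ⟩ y) ⟩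
      dot (unit ⟨ L c ⟩) y + dot (unit ⟨ R c ⟩) y + y ⟨ R (ii c) ⟩
        ≡⟨ cong₂ (λ s t → s + t + y ⟨ R (ii c) ⟩) (dot-unit ⟨ L c ⟩ y) (dot-unit ⟨ R c ⟩ y) ⟩
      y ⟨ L c ⟩ + y ⟨ R c ⟩ + y ⟨ R (ii c) ⟩
        ∎

    clique-embed : ∀ x c → dot (clique c) (embed x) ≡ 1ℚ
    clique-embed x c = case diagonal? c of λ where
      (yes diagonal) → begin
        dot (clique c) (embed x)             ≡⟨ clique-diagonal (embed x) diagonal ⟩
        embed x ⟨ L c ⟩ + embed x ⟨ R c ⟩    ≡⟨ cong₂ _+_ (embed-L x c) (embed-R-diagonal x diagonal) ⟩
        x c + (1ℚ - x c)                     ≡⟨ solve 1 (λ u → u :+ (con 1ℚ :- u) := con 1ℚ) refl (x c) ⟩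
        1ℚ                                   ∎
      (no off) → begin
        dot (clique c) (embed x)
          ≡⟨ clique-offDiagonal (embed x) off ⟩
        embed x ⟨ L c ⟩ + embed x ⟨ R c ⟩ + embed x ⟨ R (ii c) ⟩
          ≡⟨ cong₂ _+_ (cong₂ _+_ (embed-L x c) (embed-R-offDiagonal x off)) (embed-R-diagonal x (ii-diagonal c)) ⟩
        x c + (x (ii c) - x c) + (1ℚ - x (ii c))
          ≡⟨ solve 2 (λ u a → u :+ (a :- u) :+ (con 1ℚ :- a) := con 1ℚ) refl (x c) (x (ii c)) ⟩
        1ℚ ∎

    module _ {x} (vertex : BQPVertex n x) where

      private
        bits : Binary x
        bits = proj₁ vertex

        a b : Coord → ℚ
        a c = x (ii c)
        b c = x (jj c)

        embed-L-product : ∀ c → embed x ⟨ L c ⟩ ≡ a c * b c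
        embed-L-product c = trans (embed-L x c) (BQPVertex⇒product vertex c)

        embed-R-difference : ∀ {c} → ¬ IsDiagonal c → embed x ⟨ R c ⟩ ≡ a c - a c * b c
        embed-R-difference {c} off =
          trans (embed-R-offDiagonal x off) (cong (λ s → a c - s) (BQPVertex⇒product vertex c))

        embed-R-ii : ∀ c → embed x ⟨ R (ii c) ⟩ ≡ 1ℚ - a c
        embed-R-ii c = embed-R-diagonal x (ii-diagonal c)

        embed-R-jj : ∀ c → embed x ⟨ R (jj c) ⟩ ≡ 1ℚ - b c
        embed-R-jj c = embed-R-diagonal x (jj-diagonal c)

      embed-binary : Binary (embed x)
      embed-binary = every-side λ where
        (L c) → subst IsBit (sym (embed-L x c)) (bits c)
        (R c) → case diagonal? c of λ where
          (yes diagonal) → subst IsBit (sym (embed-R-diagonal x diagonal)) (bit-complement (bits c))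
          (no off)       → subst IsBit (sym (embed-R-difference off)) (bit-difference (bits (ii c)) (bits (jj c)))

      embed-arc-≤ : ∀ {u v} → Arc u v → embed x ⟨ u ⟩ + embed x ⟨ v ⟩ ≤ 1ℚ
      embed-arc-≤ (L-R c) = case diagonal? c of λ where
        (yes diagonal) → ≤-trans (≤-reflexive (cong₂ _+_ (embed-L x c) (embed-R-diagonal x diagonal)))
                                  (bit-complement-≤ (bits c))
        (no off)       → ≤-trans (≤-reflexive (cong₂ _+_ (embed-L-product c) (embed-R-difference off)))
                                  (product-difference-≤ (bits (ii c)) (bits (jj c)))
      embed-arc-≤ (L-Rii {c} off) =
        ≤-trans (≤-reflexive (cong₂ _+_ (embed-L-product c) (embed-R-ii c)))
                (product-complementˡ-≤ (bits (ii c)) (bits (jj c)))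
      embed-arc-≤ (L-Rjj {c} off) =
        ≤-trans (≤-reflexive (cong₂ _+_ (embed-L-product c) (embed-R-jj c)))
                (product-complementʳ-≤ (bits (ii c)) (bits (jj c)))
      embed-arc-≤ (R-Rii {c} off) =
        ≤-trans (≤-reflexive (cong₂ _+_ (embed-R-difference off) (embed-R-ii c)))
                (difference-complement-≤ (bits (ii c)) (bits (jj c)))
      embed-arc-≤ (R-Ljj {c} off) =
        ≤-trans (≤-reflexive (cong₂ _+_ (embed-R-difference off) (embed-L x (jj c))))
                (difference-+-≤ (bits (ii c)) (bits (jj c)))

      embed-stable : SSPVertex G (embed x)
      embed-stable = arcs-≤⇒stable embed-binary embed-arc-≤

    clique-≤ : ∀ {y} → SSPVertex G y → ∀ c → dot (clique c) y ≤ 1ℚ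
    clique-≤ {y} stable@(bits , _) c = case diagonal? c of λ where
      (yes diagonal) → ≤-trans (≤-reflexive (clique-diagonal y diagonal)) (arc-≤ stable (L-R c))
      (no off)       → ≤-trans (≤-reflexive (clique-offDiagonal y off))
        (bits-pairwise-≤⇒≤ (bits ⟨ L c ⟩) (bits ⟨ R c ⟩) (bits ⟨ R (ii c) ⟩)
          (arc-≤ stable (L-R c)) (arc-≤ stable (L-Rii off)) (arc-≤ stable (R-Rii off)))

    normal : Point (tri n ℕ.+ tri n)
    normal v = Σℚ (λ c → clique c v)

    level : ℚ
    level = Σℚ {tri n} (λ _ → 1ℚ)

    normal-valid : ∀ y → SSPVertex G y → dot normal y ≤ level
    normal-valid y stable = ≤-trans (≤-reflexive (dot-Σˡ clique y)) (Σℚ-mono-≤ (clique-≤ stable))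

    embed-normal : ∀ x → dot normal (embed x) ≡ level
    embed-normal x = trans (dot-Σˡ clique (embed x)) (Σℚ-cong (clique-embed x))

    normal-tight⇒clique-tight : ∀ {y} → SSPVertex G y → dot normal y ≡ level → ∀ c → dot (clique c) y ≡ 1ℚ
    normal-tight⇒clique-tight {y} stable tight = Σℚ-mono-≤-≡⇒≗ (clique-≤ stable) (trans (sym (dot-Σˡ clique y)) tight)

    restrict : Point (tri n ℕ.+ tri n) → Point (tri n)
    restrict y c = y ⟨ L c ⟩

    module _ {y} (stable : SSPVertex G y) (tight : ∀ c → dot (clique c) y ≡ 1ℚ) where

      private
        bits : Binary y
        bits = proj₁ stable

      R-diagonal : ∀ {c} → IsDiagonal c → y ⟨ R c ⟩ ≡ 1ℚ - y ⟨ L c ⟩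
      R-diagonal {c} diagonal = +-≡⇒≡-ˡ (y ⟨ L c ⟩) (trans (sym (clique-diagonal y diagonal)) (tight c))

      clique-offDiagonal-tight : ∀ {c} → ¬ IsDiagonal c → y ⟨ L c ⟩ + y ⟨ R c ⟩ + (1ℚ - y ⟨ L (ii c) ⟩) ≡ 1ℚ
      clique-offDiagonal-tight {c} off = begin
        y ⟨ L c ⟩ + y ⟨ R c ⟩ + (1ℚ - y ⟨ L (ii c) ⟩)
          ≡⟨ cong (y ⟨ L c ⟩ + y ⟨ R c ⟩ +_) (R-diagonal (ii-diagonal c)) ⟨
        y ⟨ L c ⟩ + y ⟨ R c ⟩ + y ⟨ R (ii c) ⟩
          ≡⟨ clique-offDiagonal y off ⟨
        dot (clique c) y
          ≡⟨ tight c ⟩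
        1ℚ ∎

      R-offDiagonal : ∀ {c} → ¬ IsDiagonal c → y ⟨ R c ⟩ ≡ y ⟨ L (ii c) ⟩ - y ⟨ L c ⟩
      R-offDiagonal {c} off = begin
        v                             ≡⟨ solve 3 (λ u v a → v := u :+ v :+ (con 1ℚ :- a) :- con 1ℚ :+ a :- u) refl u v a ⟩
        u + v + (1ℚ - a) - 1ℚ + a - u ≡⟨ cong (λ s → s - 1ℚ + a - u) (clique-offDiagonal-tight off) ⟩
        1ℚ - 1ℚ + a - u               ≡⟨ solve 2 (λ a u → con 1ℚ :- con 1ℚ :+ a :- u := a :- u) refl a u ⟩
        a - u                         ∎
        where
        u = y ⟨ L c ⟩
        v = y ⟨ R c ⟩
        a = y ⟨ L (ii c) ⟩

      restrict-product : ∀ c → y ⟨ L c ⟩ ≡ y ⟨ L (ii c) ⟩ * y ⟨ L (jj c) ⟩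
      restrict-product c = case diagonal? c of λ where
        (yes diagonal) → subst₂ (λ s t → y ⟨ L c ⟩ ≡ y ⟨ L s ⟩ * y ⟨ L t ⟩)
                                (sym (diagonal⇒ii≡ diagonal)) (sym (diagonal⇒jj≡ diagonal))
                                (bit-idempotent (bits ⟨ L c ⟩))
        (no off)       → mcCormick (bits ⟨ L (ii c) ⟩) (bits ⟨ L (jj c) ⟩) (bits ⟨ L c ⟩) (bits ⟨ R c ⟩)
          (clique-offDiagonal-tight off)
          (≤-trans (≤-reflexive (cong (y ⟨ L c ⟩ +_) (sym (R-diagonal (jj-diagonal c))))) (arc-≤ stable (L-Rjj off)))
          (arc-≤ stable (R-Ljj off))

      restrict-BQPVertex : BQPVertex n (restrict y)
      restrict-BQPVertex = product⇒BQPVertex (λ c → bits ⟨ L c ⟩) restrict-product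

      embed-restrict : embed (restrict y) ≈ y
      embed-restrict = every-side λ where
        (L c) → embed-L (restrict y) c
        (R c) → case diagonal? c of λ where
          (yes diagonal) → trans (embed-R-diagonal (restrict y) diagonal) (sym (R-diagonal diagonal))
          (no off)       → trans (embed-R-offDiagonal (restrict y) off) (sym (R-offDiagonal off))

    origin-BQPVertex : BQPVertex n (λ _ → 0ℚ)
    origin-BQPVertex = (λ _ → inj₁ refl) , λ _ _ _ _ _ _ _ → refl

    Face : PSet (tri n ℕ.+ tri n)
    Face z = SSP G z × dot normal z ≡ level

    BQP-into-Face : ∀ x → BQP n x → Face (embed x)
    BQP-into-Face x bqp = Conv-image embedding {BQPVertex n} {SSPVertex G} (λ x → embed-stable) x bqp , embed-normal x

    Face-onto-BQP : ∀ z → Face z → ∃ λ x → BQP n x × embed x ≈ z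
    Face-onto-BQP z (conv , on-face) =
      Conv-preimage embedding {BQPVertex n} {λ y → SSPVertex G y × dot normal y ≡ level} tight-preimage z
        (Conv-tight normal level normal-valid (embed-stable origin-BQPVertex) (embed-normal (λ _ → 0ℚ)) z conv on-face)
      where
      tight-preimage : ∀ y → SSPVertex G y × dot normal y ≡ level → ∃ λ x → BQPVertex n x × embed x ≈ y
      tight-preimage y (stable , tight) = restrict y , restrict-BQPVertex stable t , embed-restrict stable t
        where t = normal-tight⇒clique-tight stable tight

    embed-injective : ∀ x x′ → embed x ≈ embed x′ → x ≈ x′
    embed-injective x x′ eq c = trans (sym (embed-L x c)) (trans (eq ⟨ L c ⟩) (embed-L x′ c))

    BQP≤A-SSP : BQP n ≤A SSP G
    BQP≤A-SSP = inj₂ (Face , Conv-face normal level normal-valid ,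
                      affEquiv embedding embed-injective BQP-into-Face Face-onto-BQP)

open import Data.Nat using (ℕ; suc; _*_; _≤_)
open import Data.Nat using (zero; _+_)
open import Data.Nat.Tactic.RingSolver using (solve-∀)
open import Data.Product using (Σ)
open import Data.Product using (_,_)
open import Relation.Binary.PropositionalEquality using (_≡_; refl; cong; subst)
open Relation.Binary.PropositionalEquality.≡-Reasoning

tri-double : ∀ n → tri n + tri n ≡ n * suc n
tri-double zero    = refl
tri-double (suc n) = begin
  tri n + suc n + (tri n + suc n) ≡⟨ regroup (tri n) n ⟩
  tri n + tri n + 2 * suc n       ≡⟨ cong (_+ 2 * suc n) (tri-double n) ⟩
  n * suc n + 2 * suc n           ≡⟨ expand n ⟩
  suc n * suc (suc n)             ∎
  where
  regroup : ∀ t m → t + suc m + (t + suc m) ≡ t + t + 2 * suc m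
  regroup = solve-∀
  expand : ∀ m → m * suc m + 2 * suc m ≡ suc m * suc (suc m)
  expand = solve-∀

theorem1 : (n : ℕ) → 1 ≤ n → Σ (Graph (n * suc n)) λ G → BQP n ≤A SSP G
theorem1 n _ = subst (λ k → Σ (Graph k) λ G → BQP n ≤A SSP G) (tri-double n) (G , BQP≤A-SSP)
  where open Construction n
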